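{- Let $\sigma$ be an $\mathsf{rseq}$-substitution and $\overline{w},\overline{y}\in\mathsf{rseq}$. Then $\sigma_{\overline{w}\mapsto\overline{y}}$ is well defined: for every $\overline{x}\in\mathsf{rseq}$ and every atom $p$, if $\overline{z_1}\overline{w}\rightsquigarrow\overline{x}$ and $\overline{z_2}\overline{w}\rightsquigarrow\overline{x}$ for sequences $\overline{z_1},\overline{z_2}\in\mathsf{seq}$, then $\sigma^{\mathsf{red}(\overline{z_1}\overline{y})}(p)=\sigma^{\mathsf{red}(\overline{z_2}\overline{y})}(p)$.
   Context: $\mathsf{seq}$ is the set of finite sequences over $\{l,r,\lambda,\rho,n\}$, juxtaposition = concatenation. One-step reduction $\rightsquigarrow'$ is generated by: $\overline{x}l\lambda\overline{y}\rightsquigarrow'\overline{x}\rho\overline{y}$; $\overline{x}r\lambda\overline{y}\rightsquigarrow'\overline{x}\overline{y}$; $\overline{x}\lambda r\overline{y}\rightsquigarrow'\overline{x}\overline{y}$; $\overline{x}\rho r\overline{y}\rightsquigarrow'\overline{x}l\overline{y}$; $\overline{x}nn\overline{y}\rightsquigarrow'\overline{x}\overline{y}$. A sequence is reduced if no step applies; $\mathsf{rseq}$ is the set of reduced sequences; $\rightsquigarrow$ is the reflexive-transitive closure of $\rightsquigarrow'$; $\mathsf{red}(\overline{z})$ is the unique reduced sequence to which $\overline{z}$ reduces. An $\mathsf{rseq}$-substitution is a function $\sigma:\mathsf{rseq}\times\mathsf{At}\to$ formulas (over a set of atoms $\mathsf{At}$), written $\sigma^{\overline{x}}(p)$. The function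 $\sigma_{\overline{w}\mapsto\overline{y}}:\mathsf{rseq}\times\mathsf{At}\to$ formulas is defined by $\sigma^{\overline{x}}_{\overline{w}\mapsto\overline{y}}(p)=\sigma^{\mathsf{red}(\overline{z}\overline{y})}(p)$ if $\overline{z}\overline{w}\rightsquigarrow\overline{x}$ for some $\overline{z}\in\mathsf{seq}$, and $\sigma^{\overline{x}}_{\overline{w}\mapsto\overline{y}}(p)=\sigma^{\overline{x}}(p)$ otherwise. -}

module Defs where

open import Data.List using (List; []; _∷_; _++_; length)
open import Data.Maybe using (Maybe; just; nothing)
open import Data.Bool using (Bool; true; false; T)
open import Data.Nat using (ℕ; zero; suc)
open import Data.Product using (Σ; _,_)
open import Data.Unit using (tt)
open import Relation.Binary.PropositionalEquality using (_≡_; refl; sym; subst)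
open import Relation.Binary.Construct.Closure.ReflexiveTransitive using (Star)

data Sym : Set where
  l r λ' ρ n : Sym

Seq : Set
Seq = List Sym

data Rule : Seq → Seq → Set where
  lλ : Rule (l ∷ λ' ∷ []) (ρ ∷ [])
  rλ : Rule (r ∷ λ' ∷ []) []
  λr : Rule (λ' ∷ r ∷ []) []
  ρr : Rule (ρ ∷ r ∷ []) (l ∷ [])
  nn : Rule (n ∷ n ∷ []) []

data _⇝'_ : Seq → Seq → Set where
  step : ∀ x y {u v} → Rule u v → (x ++ u ++ y) ⇝' (x ++ v ++ y)

_⇝_ : Seq → Seq → Set
_⇝_ = Star _⇝'_

redex? : Sym → Sym → Bool
redex? l λ' = true
redex? r λ' = true
redex? λ' r = true
redex? ρ r = true
redex? n n = true
redex? _ _ = false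

isReducedFrom : Sym → Seq → Bool
isReducedFrom a [] = true
isReducedFrom a (b ∷ xs) with redex? a b
... | true = false
... | false = isReducedFrom b xs

isReduced : Seq → Bool
isReduced [] = true
isReduced (a ∷ xs) = isReducedFrom a xs

Reduced : Seq → Set
Reduced x = T (isReduced x)

RSeq : Set
RSeq = Σ Seq Reduced

contract : Sym → Sym → Maybe Seq
contract l λ' = just (ρ ∷ [])
contract r λ' = just []
contract λ' r = just []
contract ρ r = just (l ∷ [])
contract n n = just []
contract _ _ = nothing

stepFrom : Sym → Seq → Maybe Seq
stepFrom a [] = nothing
stepFrom a (b ∷ xs) with contract a b
... | just v = just (v ++ xs)
... | nothing with stepFrom b xs
...   | just ys = just (a ∷ ys)
...   | nothing = nothing

stepL : Seq → Maybe Seq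
stepL [] = nothing
stepL (a ∷ xs) = stepFrom a xs

-- every step strictly shortens the sequence, so |x| steps suffice
normFuel : ℕ → Seq → Seq
normFuel zero x = x
normFuel (suc k) x with stepL x
... | just y = normFuel k y
... | nothing = x

norm : Seq → Seq
norm x = normFuel (length x) x

-- red(z): the reduced sequence to which z reduces (norm always yields a
-- reduced sequence; the else-branch is unreachable and only packages the proof)
packR : (m : Seq) → (b : Bool) → isReduced m ≡ b → RSeq
packR m true eq = m , subst T (sym eq) tt
packR m false eq = [] , tt

red : Seq → RSeq
red z = packR (norm z) (isReduced (norm z)) refl

{-# OPTIONS --safe #-}
module Submission where

-- Reading a sequence from left to right onto a stack that contracts a redex as
-- soon as it appears on top computes eval z, an invariant of ⇝ that is the
-- reversal of z when z is reduced; hence red z is the reversal of eval z.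
-- On reduced stacks pushing a letter is injective (λ and r undo each other, n
-- undoes itself, l and ρ never contract), so eval (z ++ w) determines eval z,
-- which in turn determines eval (z ++ y).

open import Defs
open import Data.Bool using (false; T)
open import Data.List using (List; []; _∷_; [_]; _++_; length; foldl; reverse; reverseAcc)
open import Data.List.Properties using (foldl-++; length-++; reverse-involutive)
open import Data.Maybe using (Maybe; just; nothing)
open import Data.Nat using (_≤_; _<_; zero; suc; s≤s; z≤n)
open import Data.Nat.Properties using (≤-refl; ≤-trans; ≤-pred; +-monoʳ-<; +-monoˡ-<)
open import Data.Product using (proj₁; _,_)
open import Data.Unit using (tt)
open import Relation.Binary.PropositionalEquality
  using (_≡_; refl; sym; trans; cong; module ≡-Reasoning)
open import Relation.Binary.Construct.Closure.ReflexiveTransitive using (ε; _◅_)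

-- A stack holds the letters read so far in reverse order, its top at the head.
Stack : Set
Stack = List Sym

push : Stack → Sym → Stack
push s        l  = l ∷ s
push s        ρ  = ρ ∷ s
push (l ∷ s)  λ' = ρ ∷ s
push (r ∷ s)  λ' = s
push s        λ' = λ' ∷ s
push (λ' ∷ s) r  = s
push (ρ ∷ s)  r  = l ∷ s
push s        r  = r ∷ s
push (n ∷ s)  n  = s
push s        n  = n ∷ s

pushAll : Stack → Seq → Stack
pushAll = foldl push

eval : Seq → Stack
eval = pushAll []

data ReducedStack : Stack → Set where
  empty     : ReducedStack []
  singleton : ∀ a → ReducedStack [ a ]
  cons      : ∀ {a b s} → redex? a b ≡ false → ReducedStack (a ∷ s) → ReducedStack (b ∷ a ∷ s)

reducedStack-tail : ∀ {a s} → ReducedStack (a ∷ s) → ReducedStack s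
reducedStack-tail (singleton _) = empty
reducedStack-tail (cons _ rs)   = rs

reducedStack-replaceTop : ∀ {a b s} → (∀ c → redex? c b ≡ false) →
                          ReducedStack (a ∷ s) → ReducedStack (b ∷ s)
reducedStack-replaceTop _      (singleton _)       = singleton _
reducedStack-replaceTop ¬redex (cons {a = c} _ rs) = cons (¬redex c) rs

redex?-l : ∀ a → redex? a l ≡ false
redex?-l l  = refl
redex?-l r  = refl
redex?-l λ' = refl
redex?-l ρ  = refl
redex?-l n  = refl

redex?-ρ : ∀ a → redex? a ρ ≡ false
redex?-ρ l  = refl
redex?-ρ r  = refl
redex?-ρ λ' = refl
redex?-ρ ρ  = refl
redex?-ρ n  = refl

push-[] : ∀ a → push [] a ≡ [ a ]
push-[] l  = refl
push-[] r  = refl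
push-[] λ' = refl
push-[] ρ  = refl
push-[] n  = refl

push-reduced : ∀ {s} a → ReducedStack s → ReducedStack (push s a)
push-reduced {[]}     a  _  rewrite push-[] a = singleton a
push-reduced {b ∷ s}  l  rs = cons (redex?-l b) rs
push-reduced {b ∷ s}  ρ  rs = cons (redex?-ρ b) rs
push-reduced {l ∷ s}  λ' rs = reducedStack-replaceTop redex?-ρ rs
push-reduced {r ∷ s}  λ' rs = reducedStack-tail rs
push-reduced {λ' ∷ s} λ' rs = cons refl rs
push-reduced {ρ ∷ s}  λ' rs = cons refl rs
push-reduced {n ∷ s}  λ' rs = cons refl rs
push-reduced {λ' ∷ s} r  rs = reducedStack-tail rs
push-reduced {ρ ∷ s}  r  rs = reducedStack-replaceTop redex?-l rs
push-reduced {l ∷ s}  r  rs = cons refl rs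
push-reduced {r ∷ s}  r  rs = cons refl rs
push-reduced {n ∷ s}  r  rs = cons refl rs
push-reduced {n ∷ s}  n  rs = reducedStack-tail rs
push-reduced {l ∷ s}  n  rs = cons refl rs
push-reduced {r ∷ s}  n  rs = cons refl rs
push-reduced {λ' ∷ s} n  rs = cons refl rs
push-reduced {ρ ∷ s}  n  rs = cons refl rs

pushAll-reduced : ∀ {s} xs → ReducedStack s → ReducedStack (pushAll s xs)
pushAll-reduced []       rs = rs
pushAll-reduced (a ∷ xs) rs = pushAll-reduced xs (push-reduced a rs)

eval-reduced : ∀ xs → ReducedStack (eval xs)
eval-reduced xs = pushAll-reduced xs empty

push-stable : ∀ {a b s} → redex? a b ≡ false → push (a ∷ s) b ≡ b ∷ a ∷ s
push-stable {b = l}    _ = refl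
push-stable {b = ρ}    _ = refl
push-stable {l}  {λ'}  ()
push-stable {r}  {λ'}  ()
push-stable {λ'} {λ'}  _ = refl
push-stable {ρ}  {λ'}  _ = refl
push-stable {n}  {λ'}  _ = refl
push-stable {l}  {r}   _ = refl
push-stable {r}  {r}   _ = refl
push-stable {λ'} {r}   ()
push-stable {ρ}  {r}   ()
push-stable {n}  {r}   _ = refl
push-stable {l}  {n}   _ = refl
push-stable {r}  {n}   _ = refl
push-stable {λ'} {n}   _ = refl
push-stable {ρ}  {n}   _ = refl
push-stable {n}  {n}   ()

push-λ'-r : ∀ {s} → ReducedStack s → push (push s λ') r ≡ s
push-λ'-r {[]}         _             = refl
push-λ'-r {l ∷ s}      _             = refl
push-λ'-r {r ∷ []}     _             = refl
push-λ'-r {r ∷ a ∷ s}  (cons ¬rdx _) = push-stable ¬rdx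
push-λ'-r {λ' ∷ s}     _             = refl
push-λ'-r {ρ ∷ s}      _             = refl
push-λ'-r {n ∷ s}      _             = refl

push-r-λ' : ∀ {s} → ReducedStack s → push (push s r) λ' ≡ s
push-r-λ' {[]}         _             = refl
push-r-λ' {l ∷ s}      _             = refl
push-r-λ' {r ∷ s}      _             = refl
push-r-λ' {λ' ∷ []}    _             = refl
push-r-λ' {λ' ∷ a ∷ s} (cons ¬rdx _) = push-stable ¬rdx
push-r-λ' {ρ ∷ s}      _             = refl
push-r-λ' {n ∷ s}      _             = refl

push-n-n : ∀ {s} → ReducedStack s → push (push s n) n ≡ s
push-n-n {[]}        _             = refl
push-n-n {l ∷ s}     _             = refl
push-n-n {r ∷ s}     _             = refl
push-n-n {λ' ∷ s}    _             = refl
push-n-n {ρ ∷ s}     _             = refl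
push-n-n {n ∷ []}    _             = refl
push-n-n {n ∷ a ∷ s} (cons ¬rdx _) = push-stable ¬rdx

pushAll-rule : ∀ {s u v} → ReducedStack s → Rule u v → pushAll s u ≡ pushAll s v
pushAll-rule rs lλ = refl
pushAll-rule rs rλ = push-r-λ' rs
pushAll-rule rs λr = push-λ'-r rs
pushAll-rule rs ρr = refl
pushAll-rule rs nn = push-n-n rs

eval-++ : ∀ x y → eval (x ++ y) ≡ pushAll (eval x) y
eval-++ = foldl-++ push []

eval-⇝' : ∀ {x y} → x ⇝' y → eval x ≡ eval y
eval-⇝' (step x y {u} {v} rule) = begin
  eval (x ++ u ++ y)             ≡⟨ eval-++ x (u ++ y) ⟩
  pushAll (eval x) (u ++ y)      ≡⟨ foldl-++ push (eval x) u y ⟩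
  pushAll (pushAll (eval x) u) y ≡⟨ cong (λ s → pushAll s y) (pushAll-rule (eval-reduced x) rule) ⟩
  pushAll (pushAll (eval x) v) y ≡⟨ foldl-++ push (eval x) v y ⟨
  pushAll (eval x) (v ++ y)      ≡⟨ eval-++ x (v ++ y) ⟨
  eval (x ++ v ++ y)             ∎
  where open ≡-Reasoning

eval-⇝ : ∀ {x y} → x ⇝ y → eval x ≡ eval y
eval-⇝ ε        = refl
eval-⇝ (s ◅ ss) = trans (eval-⇝' s) (eval-⇝ ss)

push-injective : ∀ {s₁ s₂} a → ReducedStack s₁ → ReducedStack s₂ →
                 push s₁ a ≡ push s₂ a → s₁ ≡ s₂
push-injective l  _   _   refl = refl
push-injective ρ  _   _   refl = refl
push-injective λ' rs₁ rs₂ eq = trans (sym (push-λ'-r rs₁)) (trans (cong (λ s → push s r) eq) (push-λ'-r rs₂))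
push-injective r  rs₁ rs₂ eq = trans (sym (push-r-λ' rs₁)) (trans (cong (λ s → push s λ') eq) (push-r-λ' rs₂))
push-injective n  rs₁ rs₂ eq = trans (sym (push-n-n rs₁)) (trans (cong (λ s → push s n) eq) (push-n-n rs₂))

pushAll-injective : ∀ {s₁ s₂} xs → ReducedStack s₁ → ReducedStack s₂ →
                    pushAll s₁ xs ≡ pushAll s₂ xs → s₁ ≡ s₂
pushAll-injective []       _   _   eq = eq
pushAll-injective (a ∷ xs) rs₁ rs₂ eq =
  push-injective a rs₁ rs₂ (pushAll-injective xs (push-reduced a rs₁) (push-reduced a rs₂) eq)

eval-cancelʳ : ∀ x₁ x₂ w → eval (x₁ ++ w) ≡ eval (x₂ ++ w) → eval x₁ ≡ eval x₂
eval-cancelʳ x₁ x₂ w eq = pushAll-injective w (eval-reduced x₁) (eval-reduced x₂) (begin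
  pushAll (eval x₁) w ≡⟨ eval-++ x₁ w ⟨
  eval (x₁ ++ w)      ≡⟨ eq ⟩
  eval (x₂ ++ w)      ≡⟨ eval-++ x₂ w ⟩
  pushAll (eval x₂) w ∎)
  where open ≡-Reasoning

eval-congʳ : ∀ x₁ x₂ y → eval x₁ ≡ eval x₂ → eval (x₁ ++ y) ≡ eval (x₂ ++ y)
eval-congʳ x₁ x₂ y eq = begin
  eval (x₁ ++ y)      ≡⟨ eval-++ x₁ y ⟩
  pushAll (eval x₁) y ≡⟨ cong (λ s → pushAll s y) eq ⟩
  pushAll (eval x₂) y ≡⟨ eval-++ x₂ y ⟨
  eval (x₂ ++ y)      ∎
  where open ≡-Reasoning

pushAll-reducedFrom : ∀ {a s} xs → T (isReducedFrom a xs) → pushAll (a ∷ s) xs ≡ reverseAcc (a ∷ s) xs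
pushAll-reducedFrom []               _   = refl
pushAll-reducedFrom {a} {s} (b ∷ xs) red with redex? a b in ¬rdx
... | false rewrite push-stable {s = s} ¬rdx = pushAll-reducedFrom xs red

eval-reverse : ∀ x → Reduced x → eval x ≡ reverse x
eval-reverse []       _   = refl
eval-reverse (a ∷ xs) red rewrite push-[] a = pushAll-reducedFrom xs red

data Contraction (a b : Sym) : Maybe Seq → Set where
  redex  : ∀ {v} → Rule (a ∷ b ∷ []) v → Contraction a b (just v)
  stable : redex? a b ≡ false → Contraction a b nothing

contraction : ∀ a b → Contraction a b (contract a b)
contraction l  λ' = redex lλ
contraction r  λ' = redex rλ
contraction λ' r  = redex λr
contraction ρ  r  = redex ρr
contraction n  n  = redex nn
contraction l  l  = stable refl
contraction l  r  = stable refl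
contraction l  ρ  = stable refl
contraction l  n  = stable refl
contraction r  l  = stable refl
contraction r  r  = stable refl
contraction r  ρ  = stable refl
contraction r  n  = stable refl
contraction λ' l  = stable refl
contraction λ' λ' = stable refl
contraction λ' ρ  = stable refl
contraction λ' n  = stable refl
contraction ρ  l  = stable refl
contraction ρ  λ' = stable refl
contraction ρ  ρ  = stable refl
contraction ρ  n  = stable refl
contraction n  l  = stable refl
contraction n  r  = stable refl
contraction n  λ' = stable refl
contraction n  ρ  = stable refl

data LeftmostStep (x : Seq) : Maybe Seq → Set where
  reducible   : ∀ {y} → x ⇝' y → LeftmostStep x (just y)
  irreducible : Reduced x → LeftmostStep x nothing

⇝'-cons : ∀ a {x y} → x ⇝' y → (a ∷ x) ⇝' (a ∷ y)
⇝'-cons a (step x y rule) = step (a ∷ x) y rule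

reducedFrom-cons : ∀ {a b} xs → redex? a b ≡ false → T (isReducedFrom b xs) → T (isReducedFrom a (b ∷ xs))
reducedFrom-cons xs ¬rdx red rewrite ¬rdx = red

stepFrom-leftmost : ∀ a xs → LeftmostStep (a ∷ xs) (stepFrom a xs)
stepFrom-leftmost a []       = irreducible tt
stepFrom-leftmost a (b ∷ xs) with contract a b | contraction a b
... | just _  | redex rule = reducible (step [] xs rule)
... | nothing | stable ¬rdx with stepFrom b xs | stepFrom-leftmost b xs
...   | just _  | reducible st    = reducible (⇝'-cons a st)
...   | nothing | irreducible red = irreducible (reducedFrom-cons xs ¬rdx red)

stepL-leftmost : ∀ x → LeftmostStep x (stepL x)
stepL-leftmost []       = irreducible tt
stepL-leftmost (a ∷ xs) = stepFrom-leftmost a xs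

Rule-shortens : ∀ {u v} → Rule u v → length v < length u
Rule-shortens lλ = s≤s (s≤s z≤n)
Rule-shortens rλ = s≤s z≤n
Rule-shortens λr = s≤s z≤n
Rule-shortens ρr = s≤s (s≤s z≤n)
Rule-shortens nn = s≤s z≤n

⇝'-shortens : ∀ {x y} → x ⇝' y → length y < length x
⇝'-shortens (step x y {u} {v} rule)
  rewrite length-++ x {v ++ y} | length-++ x {u ++ y} | length-++ v {y} | length-++ u {y}
  = +-monoʳ-< (length x) (+-monoˡ-< (length y) (Rule-shortens rule))

normFuel-⇝ : ∀ k x → x ⇝ normFuel k x
normFuel-⇝ zero    x = ε
normFuel-⇝ (suc k) x with stepL x | stepL-leftmost x
... | just y  | reducible st  = st ◅ normFuel-⇝ k y
... | nothing | irreducible _ = ε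

normFuel-reduced : ∀ k x → length x ≤ k → Reduced (normFuel k x)
normFuel-reduced zero    []  _ = tt
normFuel-reduced (suc k) x   len≤ with stepL x | stepL-leftmost x
... | just y  | reducible st    = normFuel-reduced k y (≤-pred (≤-trans (⇝'-shortens st) len≤))
... | nothing | irreducible red = red

norm-⇝ : ∀ z → z ⇝ norm z
norm-⇝ z = normFuel-⇝ (length z) z

norm-reduced : ∀ z → Reduced (norm z)
norm-reduced z = normFuel-reduced (length z) z ≤-refl

norm≡reverse-eval : ∀ z → norm z ≡ reverse (eval z)
norm≡reverse-eval z = begin
  norm z                     ≡⟨ reverse-involutive (norm z) ⟨
  reverse (reverse (norm z)) ≡⟨ cong reverse (eval-reverse (norm z) (norm-reduced z)) ⟨
  reverse (eval (norm z))    ≡⟨ cong reverse (eval-⇝ (norm-⇝ z)) ⟨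
  reverse (eval z)           ∎
  where open ≡-Reasoning

red-cong-eval : ∀ z₁ z₂ → eval z₁ ≡ eval z₂ → red z₁ ≡ red z₂
red-cong-eval z₁ z₂ eq =
  cong (λ m → packR m (isReduced m) refl)
       (trans (norm≡reverse-eval z₁) (trans (cong reverse eq) (sym (norm≡reverse-eval z₂))))

lemma33 : {At F : Set} (σ : RSeq → At → F) (w y : RSeq) (x : RSeq) (p : At)
          (z₁ z₂ : Seq) →
          (z₁ ++ proj₁ w) ⇝ proj₁ x → (z₂ ++ proj₁ w) ⇝ proj₁ x →
          σ (red (z₁ ++ proj₁ y)) p ≡ σ (red (z₂ ++ proj₁ y)) p
lemma33 σ (w , _) (y , _) _ p z₁ z₂ z₁w⇝x z₂w⇝x =
  cong (λ t → σ t p) (red-cong-eval (z₁ ++ y) (z₂ ++ y) (eval-congʳ z₁ z₂ y same-eval))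
  where
  same-eval : eval z₁ ≡ eval z₂
  same-eval = eval-cancelʳ z₁ z₂ w (trans (eval-⇝ z₁w⇝x) (sym (eval-⇝ z₂w⇝x)))
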